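{- Let $G$ be a $P$-oligomorphic permutation group of a countably infinite set $E$, and let $\mathcal L^{\infty}(G)$ be the poset (under refinement) of block systems of $G$ each of whose blocks is either infinite or contained in the kernel of $G$. Then $\mathcal L^{\infty}(G)$ is a finite sublattice of the lattice of block systems of $G$ (joins and meets being those of set partitions), with a minimum, and with maximum the trivial block system $\{E\}$.
   Context: Profile: number of $G$-orbits on $n$-subsets; $P$-oligomorphic: profile bounded by a polynomial. A block system is a $G$-invariant partition of $E$. The kernel of $G$ is the union of the finite $G$-orbits of points of $E$. -}

module Defs where

open import Level using (0ℓ) renaming (suc to lsuc)
open import Data.Nat using (ℕ; suc; _+_; _*_; _^_)
open import Data.Fin using (Fin)
open import Data.List using (List; map; length)
open import Data.List.Membership.Propositional using (_∈_)
open import Data.List.Relation.Unary.All using (All)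
open import Data.List.Relation.Unary.Any using (Any)
open import Data.List.Relation.Unary.Unique.Propositional using (Unique)
open import Data.Product using (Σ; _×_; ∃; ∃-syntax; _,_)
open import Data.Sum using (_⊎_)
open import Data.Unit using (⊤)
open import Relation.Nullary using (¬_)
open import Relation.Binary.Core using (Rel)
open import Relation.Binary.Structures using (IsEquivalence)
open import Relation.Binary.PropositionalEquality using (_≡_; _≢_)
open import Relation.Binary.Construct.Closure.ReflexiveTransitive using (Star)
open import Function.Bundles using (_↔_; Inverse; _⇔_)
open import Function.Construct.Identity using (↔-id)
open import Function.Construct.Composition using (_↔-∘_)
open import Function.Construct.Symmetry using (↔-sym)

-- The countably infinite set E is taken to be ℕ.
-- A permutation of E is a bijection ℕ ↔ ℕ.
Perm : Set
Perm = ℕ ↔ ℕ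

app : Perm → ℕ → ℕ
app g = Inverse.to g

record PermGroup : Set₁ where
  field
    _∈G : Perm → Set
    id∈ : ↔-id ℕ ∈G
    ∘∈  : ∀ {g h} → g ∈G → h ∈G → (g ↔-∘ h) ∈G
    ⁻¹∈ : ∀ {g} → g ∈G → ↔-sym g ∈G

_∈ᴳ_ : Perm → PermGroup → Set
g ∈ᴳ G = PermGroup._∈G G g

Finite : (ℕ → Set) → Set
Finite S = ∃[ xs ] (∀ y → S y → y ∈ xs)

Infinite : (ℕ → Set) → Set
Infinite S = ¬ Finite S

Orbit : PermGroup → ℕ → (ℕ → Set)
Orbit G x y = ∃[ g ] (g ∈ᴳ G × app g x ≡ y)

Kernel : PermGroup → ℕ → Set
Kernel G x = Finite (Orbit G x)

Subset : ℕ → Set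
Subset n = Σ (List ℕ) (λ A → Unique A × length A ≡ n)

elems : ∀ {n} → Subset n → List ℕ
elems (A , _) = A

SameOrbit : (G : PermGroup) → ∀ {n} → Subset n → Subset n → Set
SameOrbit G A B =
  ∃[ g ] (g ∈ᴳ G × (∀ y → (y ∈ elems B) ⇔ (y ∈ map (app g) (elems A))))

-- The number of G-orbits on n-subsets is at most N:
-- among any N+1 n-subsets, two (with distinct indices) are in the same orbit.
OrbitsAtMost : PermGroup → ℕ → ℕ → Set
OrbitsAtMost G N n =
  (f : Fin (suc N) → Subset n) → ∃[ i ] ∃[ j ] (i ≢ j × SameOrbit G (f i) (f j))

-- P-oligomorphic: the profile is bounded by a polynomial in n
-- (equivalently, by c * (1 + n) ^ k for some c, k).
POligomorphic : PermGroup → Set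
POligomorphic G = ∃[ c ] ∃[ k ] (∀ n → OrbitsAtMost G (c * (1 + n) ^ k) n)

-- Block systems: G-invariant partitions of E, represented by their
-- equivalence relations (blocks = equivalence classes).
Partition : Set₁
Partition = Rel ℕ 0ℓ

IsBlockSystem : PermGroup → Partition → Set
IsBlockSystem G R =
  IsEquivalence R × (∀ g → g ∈ᴳ G → ∀ x y → R x y → R (app g x) (app g y))

InLinf : PermGroup → Partition → Set
InLinf G R =
  IsBlockSystem G R × (∀ x → Infinite (R x) ⊎ (∀ y → R x y → Kernel G y))

_⊑_ : Partition → Partition → Set
R ⊑ S = ∀ {x y} → R x y → S x y

_≐_ : Partition → Partition → Set
R ≐ S = R ⊑ S × S ⊑ R

_⊓_ : Partition → Partition → Partition
(R ⊓ S) x y = R x y × S x y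

_⊔_ : Partition → Partition → Partition
(R ⊔ S) = Star (λ x y → R x y ⊎ S x y)

Total : Partition
Total _ _ = ⊤

module Submission where

open import Defs
open import Level using (0ℓ) renaming (suc to lsuc)
open import Axiom.ExcludedMiddle using (ExcludedMiddle)
open import Data.Empty using (⊥; ⊥-elim)
open import Data.Fin using (Fin; zero; suc; toℕ; inject≤; combine; remQuot; finToFun; funToFin)
import Data.Fin.Properties as Finₚ
open import Data.List using (List; []; _∷_; map; length; filter; _++_; take; allFin; lookup)
open import Data.List.Membership.Propositional using (_∈_; _∉_; find; lose)
open import Data.List.Membership.Propositional.Properties
  using (∈-∃++; ∈-++⁺ˡ; ∈-++⁺ʳ; ∈-++⁻; ∈-filter⁺; ∈-filter⁻; ∈-map⁺; ∈-map⁻; ∈-lookup; ∈-allFin)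
import Data.List.Properties as Listₚ
open import Data.List.Relation.Binary.Subset.Propositional using (_⊆_)
open import Data.List.Relation.Unary.All as All using (All; []; _∷_)
open import Data.List.Relation.Unary.AllPairs using ([]; _∷_)
import Data.List.Relation.Unary.All.Properties as Allₚ
open import Data.List.Relation.Unary.Any using (Any; here; there)
import Data.List.Relation.Unary.Any.Properties as Anyₚ
open import Data.List.Relation.Unary.Unique.Propositional using (Unique)
import Data.List.Relation.Unary.Unique.Propositional.Properties as Uniqueₚ
open import Data.Nat using (ℕ; zero; suc; _+_; _*_; _^_; _∸_; _≤_; _<_; z≤n; s≤s; _≤?_)
  renaming (_⊓_ to _⊓ℕ_)
open import Data.Nat.ListAction using (sum)
open import Data.Nat.Properties
open import Data.Nat.Solver using (module +-*-Solver)
open import Data.Product using (Σ; _×_; ∃-syntax; _,_; proj₁; proj₂)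
open import Data.Sum using (_⊎_; inj₁; inj₂; [_,_]′)
open import Data.Unit using (⊤; tt)
open import Data.Vec.Functional as Vector using (Vector) renaming (_∷_ to _∷ᵥ_)
open import Function using (_∘_; id)
open import Function.Bundles using (Inverse; Equivalence; _⇔_)
open import Function.Construct.Symmetry using (↔-sym)
open import Function.Definitions using (Injective)
open import Relation.Binary.Core using (Rel)
open import Relation.Binary.Definitions using (Symmetric)
open import Relation.Binary.Structures using (IsEquivalence)
open import Relation.Binary.Construct.Closure.ReflexiveTransitive
  using (ε; _◅_; _◅◅_; gmap; reverse)
open import Relation.Binary.PropositionalEquality
open import Relation.Nullary using (¬_; Dec; yes; no)
open import Relation.Nullary.Decidable using (decidable-stable)
open import Relation.Unary using (Decidable)
open import Relation.Unary.Properties using (∁?)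

-- Let the profile be bounded by c (1 + n)^k.  A block system with k + 2 infinite
-- blocks is impossible: prescribing how many of n points go into each of these
-- blocks, with multiplicities encoding D^(k+1) digit strings, produces more
-- pairwise inequivalent n-sets than c (1 + n)^k, because the number of points of
-- a set inside the block of a point z is invariant under moving z and the set by
-- the same element of G.  The kernel is finite, as G has at most c 2^k orbits on
-- points.  So every member of L∞(G) has at most k + 1 + |kernel| blocks.
-- A finite block of R ⊓ S is in the kernel: the orbit of each of its points meets
-- each of the finitely many cells (R-block ∩ S-block) inside one translate of it.
-- A finite block of R ⊔ S contains whole R-blocks, which are then in the kernel.
-- A member M with the most blocks refines every member R (otherwise M ⊓ R would
-- have more blocks), so L∞(G) consists of coarsenings of M, of which there are
-- finitely many.

app-sym-app : (g : Perm) → ∀ x → app (↔-sym g) (app g x) ≡ x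
app-sym-app g x = Inverse.inverseʳ g refl

app-app-sym : (g : Perm) → ∀ x → app g (app (↔-sym g) x) ≡ x
app-app-sym g x = Inverse.inverseˡ g refl

app-injective : (g : Perm) → Injective _≡_ _≡_ (app g)
app-injective g {x} {y} gx≡gy = begin
  x                         ≡⟨ app-sym-app g x ⟨
  app (↔-sym g) (app g x)   ≡⟨ cong (app (↔-sym g)) gx≡gy ⟩
  app (↔-sym g) (app g y)   ≡⟨ app-sym-app g y ⟩
  y                         ∎
  where open ≡-Reasoning

Orbit-sym : (G : PermGroup) → Symmetric (Orbit G)
Orbit-sym G {x} (g , g∈ , refl) = ↔-sym g , PermGroup.⁻¹∈ G g∈ , app-sym-app g x

module BlockSystem (G : PermGroup) (R : Partition) (bs : IsBlockSystem G R) where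
  open IsEquivalence (proj₁ bs) public

  invariant : ∀ {g} → g ∈ᴳ G → ∀ {x y} → R x y → R (app g x) (app g y)
  invariant {g} g∈ {x} {y} = proj₂ bs g g∈ x y

  translate⁻¹ : ∀ {g} → g ∈ᴳ G → ∀ {x y} → R (app g x) y → R x (app (↔-sym g) y)
  translate⁻¹ {g} g∈ {x} r =
    subst (λ u → R u _) (app-sym-app g x) (invariant (PermGroup.⁻¹∈ G g∈) r)

  reflect : ∀ {g} → g ∈ᴳ G → ∀ {x y} → R (app g x) (app g y) → R x y
  reflect {g} g∈ {y = y} r = subst (R _) (app-sym-app g y) (translate⁻¹ g∈ r)

module _ {A : Set} where

  ∈⇒length-remove : ∀ {x : A} {ys} → x ∈ ys →
    ∃[ zs ] (length ys ≡ suc (length zs) × (∀ {z} → z ∈ ys → z ≢ x → z ∈ zs))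
  ∈⇒length-remove x∈ with ∈-∃++ x∈
  ... | us , vs , refl = us ++ vs , Listₚ.length-++-sucʳ us _ vs , keep
    where
    keep : ∀ {z} → z ∈ us ++ _ ∷ vs → z ≢ _ → z ∈ us ++ vs
    keep z∈ z≢x with ∈-++⁻ us z∈
    ... | inj₁ p         = ∈-++⁺ˡ p
    ... | inj₂ (here p)  = ⊥-elim (z≢x p)
    ... | inj₂ (there p) = ∈-++⁺ʳ us p

  Unique-⊆⇒length-≤ : ∀ {xs ys : List A} → Unique xs → xs ⊆ ys → length xs ≤ length ys
  Unique-⊆⇒length-≤ {[]} _ _ = z≤n
  Unique-⊆⇒length-≤ {x ∷ xs} (x∉xs ∷ u) xs⊆ys with ∈⇒length-remove (xs⊆ys (here refl))
  ... | zs , len , keep rewrite len =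
    s≤s (Unique-⊆⇒length-≤ u λ y∈ → keep (xs⊆ys (there y∈)) λ { refl → All.lookup x∉xs y∈ refl })

  lookup-injective : ∀ {xs : List A} → Unique xs → Injective _≡_ _≡_ (lookup xs)
  lookup-injective {_ ∷ _} _          {zero}  {zero}  _ = refl
  lookup-injective         (x∉xs ∷ _) {zero}  {suc j} e = ⊥-elim (All.lookup x∉xs (∈-lookup j) e)
  lookup-injective         (x∉xs ∷ _) {suc i} {zero}  e = ⊥-elim (All.lookup x∉xs (∈-lookup i) (sym e))
  lookup-injective         (_ ∷ u)    {suc i} {suc j} e = cong suc (lookup-injective u e)

  length-filter-∁ : {P : A → Set} (P? : Decidable P) → ∀ xs →
    length (filter P? xs) + length (filter (∁? P?) xs) ≡ length xs
  length-filter-∁ P? [] = refl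
  length-filter-∁ P? (x ∷ xs) with P? x
  ... | yes _ = cong suc (length-filter-∁ P? xs)
  ... | no _  = trans (+-suc _ _) (cong suc (length-filter-∁ P? xs))

∈⇒≤sum : ∀ {x} xs → x ∈ xs → x ≤ sum xs
∈⇒≤sum (y ∷ xs) (here refl) = m≤m+n y (sum xs)
∈⇒≤sum (y ∷ xs) (there x∈) = ≤-trans (∈⇒≤sum xs x∈) (m≤n+m (sum xs) y)

ℕ-infinite : Infinite (λ (_ : ℕ) → ⊤)
ℕ-infinite (xs , all∈) = <-irrefl refl (∈⇒≤sum xs (all∈ (suc (sum xs)) tt))

Finite-⊆ : ∀ {S T : ℕ → Set} → (∀ {y} → S y → T y) → Finite T → Finite S
Finite-⊆ S⊆T (xs , T⊆xs) = xs , λ y → T⊆xs y ∘ S⊆T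

^-distribʳ-* : ∀ a b e → (a * b) ^ e ≡ a ^ e * b ^ e
^-distribʳ-* a b zero    = refl
^-distribʳ-* a b (suc e) = trans (cong ((a * b) *_) (^-distribʳ-* a b e))
  (solve 4 (λ a b x y → (a :* b) :* (x :* y) := (a :* x) :* (b :* y)) refl a b (a ^ e) (b ^ e))
  where open +-*-Solver

∑ : ∀ {n} → Vector ℕ n → ℕ
∑ = Vector.foldr _+_ 0

⋃ : ∀ {A : Set} {n} → Vector (List A) n → List A
⋃ = Vector.foldr _++_ []

∑-cong : ∀ {n} {f g : Vector ℕ n} → f ≗ g → ∑ f ≡ ∑ g
∑-cong {zero}  _   = refl
∑-cong {suc n} f≗g = cong₂ _+_ (f≗g zero) (∑-cong (f≗g ∘ suc))

∑-zero : ∀ {n} {f : Vector ℕ n} → (∀ i → f i ≡ 0) → ∑ f ≡ 0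
∑-zero {zero}  _   = refl
∑-zero {suc n} f≗0 = cong₂ _+_ (f≗0 zero) (∑-zero (f≗0 ∘ suc))

∑-single : ∀ {n} (f : Vector ℕ n) i → (∀ j → j ≢ i → f j ≡ 0) → ∑ f ≡ f i
∑-single f zero others =
  trans (cong (f zero +_) (∑-zero λ j → others (suc j) λ ())) (+-identityʳ _)
∑-single f (suc i) others =
  trans (cong (_+ ∑ (f ∘ suc)) (others zero λ ()))
        (∑-single (f ∘ suc) i λ j j≢i → others (suc j) (j≢i ∘ Finₚ.suc-injective))

∑-≤ : ∀ {n} {f : Vector ℕ n} {B} → (∀ i → f i ≤ B) → ∑ f ≤ n * B
∑-≤ {zero}  _   = z≤n
∑-≤ {suc n} f≤B = +-mono-≤ (f≤B zero) (∑-≤ (f≤B ∘ suc))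

module _ {A : Set} where

  ∈-⋃⁺ : ∀ {n} (F : Vector (List A) n) i {y} → y ∈ F i → y ∈ ⋃ F
  ∈-⋃⁺ F zero    y∈ = ∈-++⁺ˡ y∈
  ∈-⋃⁺ F (suc i) y∈ = ∈-++⁺ʳ (F zero) (∈-⋃⁺ (F ∘ suc) i y∈)

  ∈-⋃⁻ : ∀ {n} (F : Vector (List A) n) {y} → y ∈ ⋃ F → ∃[ i ] (y ∈ F i)
  ∈-⋃⁻ {suc n} F y∈ with ∈-++⁻ (F zero) y∈
  ... | inj₁ y∈F₀ = zero , y∈F₀
  ... | inj₂ y∈⋃  with i , y∈Fᵢ ← ∈-⋃⁻ (F ∘ suc) y∈⋃ = suc i , y∈Fᵢ

  length-⋃ : ∀ {n} (F : Vector (List A) n) → length (⋃ F) ≡ ∑ (length ∘ F)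
  length-⋃ {zero}  F = refl
  length-⋃ {suc n} F =
    trans (Listₚ.length-++ (F zero)) (cong (length (F zero) +_) (length-⋃ (F ∘ suc)))

  Unique-⋃ : ∀ {n} (F : Vector (List A) n) → (∀ i → Unique (F i)) →
    (∀ {i j y} → y ∈ F i → y ∈ F j → i ≡ j) → Unique (⋃ F)
  Unique-⋃ {zero}  F _ _ = []
  Unique-⋃ {suc n} F unique disjoint =
    Uniqueₚ.++⁺ (unique zero)
      (Unique-⋃ (F ∘ suc) (unique ∘ suc) (λ p q → Finₚ.suc-injective (disjoint p q)))
      λ (p , q) → Finₚ.0≢1+n (disjoint p (proj₂ (∈-⋃⁻ (F ∘ suc) q)))

bounded⇒maximal : ∀ {ℓ} → ExcludedMiddle ℓ → (P : ℕ → Set ℓ) → P 0 →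
  (B : ℕ) → (∀ {j} → P j → j ≤ B) → ∃[ j ] (P j × ¬ P (suc j))
bounded⇒maximal em P p₀ B bound = search (suc B) 0 p₀ ≤-refl
  where
  search : ∀ fuel i → P i → suc B ≤ i + fuel → ∃[ j ] (P j × ¬ P (suc j))
  search zero i pᵢ B<i = ⊥-elim (<⇒≱ (subst (B <_) (+-identityʳ i) B<i) (bound pᵢ))
  search (suc fuel) i pᵢ B<i+fuel with em {P (suc i)}
  ... | no ¬pᵢ₊₁ = i , pᵢ , ¬pᵢ₊₁
  ... | yes pᵢ₊₁ = search fuel (suc i) pᵢ₊₁ (subst (suc B ≤_) (+-suc i fuel) B<i+fuel)

funToFin-cong : ∀ {m n} {f g : Fin m → Fin n} → f ≗ g → funToFin f ≡ funToFin g
funToFin-cong {zero}  _   = refl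
funToFin-cong {suc m} f≗g = cong₂ combine (f≗g zero) (funToFin-cong (f≗g ∘ suc))

finToFun-injective : ∀ {m n} {x y : Fin (m ^ n)} → finToFun {m} {n} x ≗ finToFun y → x ≡ y
finToFun-injective {m} {n} {x} {y} x≗y =
  trans (sym (Finₚ.funToFin-finToFin {m = n} {n = m} x))
        (trans (funToFin-cong {f = finToFun x} {g = finToFun y} x≗y)
               (Finₚ.funToFin-finToFin {m = n} {n = m} y))

allRelations : ∀ j → List (Fin j → Fin j → Fin 2)
allRelations j = map (λ x a → finToFun (finToFun x a)) (allFin ((2 ^ j) ^ j))

allRelations-complete : ∀ {j} (h : Fin j → Fin j → Fin 2) →
  Any (λ r → ∀ a b → r a b ≡ h a b) (allRelations j)
allRelations-complete h = Anyₚ.map⁺ (lose (∈-allFin (funToFin (funToFin ∘ h))) decode)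
  where
  decode : ∀ a b → finToFun (finToFun (funToFin (funToFin ∘ h)) a) b ≡ h a b
  decode a b = trans (cong (λ x → finToFun x b) (Finₚ.finToFun-funToFin (funToFin ∘ h) a))
                     (Finₚ.finToFun-funToFin (h a) b)

indicator : ∀ {P : Set} → Dec P → Fin 2
indicator (yes _) = suc zero
indicator (no _)  = zero

indicator≡1⇒ : ∀ {P : Set} (d : Dec P) → indicator d ≡ suc zero → P
indicator≡1⇒ (yes p) _ = p

⇒indicator≡1 : ∀ {P : Set} (d : Dec P) → P → indicator d ≡ suc zero
⇒indicator≡1 (yes _) _ = refl
⇒indicator≡1 (no ¬p) p = ⊥-elim (¬p p)

Distinct : Rel ℕ 0ℓ → ∀ {j} → Vector ℕ j → Set
Distinct T p = Injective _≡_ T p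

empty-distinct : ∀ {T : Rel ℕ 0ℓ} (p : Vector ℕ 0) → Distinct T p
empty-distinct _ {()}

∷ᵥ-distinct : ∀ {T : Rel ℕ 0ℓ} {j} {p : Vector ℕ j} {w} → Symmetric T →
  Distinct T p → (∀ i → ¬ T w (p i)) → Distinct T (w ∷ᵥ p)
∷ᵥ-distinct sym inj new {zero}  {zero}  _ = refl
∷ᵥ-distinct sym inj new {zero}  {suc j} t = ⊥-elim (new j t)
∷ᵥ-distinct sym inj new {suc i} {zero}  t = ⊥-elim (new i (sym t))
∷ᵥ-distinct sym inj new {suc i} {suc j} t = cong suc (inj t)

OrbitsAtMost⇒≤ : ∀ {G N n M} → OrbitsAtMost G N n → (f : Fin M → Subset n) →
  (∀ {i j} → SameOrbit G (f i) (f j) → i ≡ j) → M ≤ N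
OrbitsAtMost⇒≤ {N = N} {M = M} atMost f separated with M ≤? N
... | yes M≤N = M≤N
... | no M≰N with atMost (λ s → f (inject≤ s (≰⇒> M≰N)))
...   | i , j , i≢j , same = ⊥-elim (i≢j (Finₚ.inject≤-injective _ _ i j (separated same)))

⊓-IsBlockSystem : ∀ {G : PermGroup} {R S : Partition} →
  IsBlockSystem G R → IsBlockSystem G S → IsBlockSystem G (R ⊓ S)
⊓-IsBlockSystem {G} {R} {S} bsR bsS =
  record { refl  = R.refl , S.refl
         ; sym   = λ (r , s) → R.sym r , S.sym s
         ; trans = λ (r , s) (r′ , s′) → R.trans r r′ , S.trans s s′ }
  , λ g g∈ x y (r , s) → R.invariant g∈ r , S.invariant g∈ s
  where
  module R = BlockSystem G R bsR
  module S = BlockSystem G S bsS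

⊔-IsBlockSystem : ∀ {G : PermGroup} {R S : Partition} →
  IsBlockSystem G R → IsBlockSystem G S → IsBlockSystem G (R ⊔ S)
⊔-IsBlockSystem {G} {R} {S} bsR bsS =
  record { refl = ε ; sym = reverse step-sym ; trans = _◅◅_ }
  , λ g g∈ x y → gmap (app g) (step-invariant g∈)
  where
  module R = BlockSystem G R bsR
  module S = BlockSystem G S bsS
  step-sym : ∀ {x y} → R x y ⊎ S x y → R y x ⊎ S y x
  step-sym = [ inj₁ ∘ R.sym , inj₂ ∘ S.sym ]′
  step-invariant : ∀ {g} → g ∈ᴳ G → ∀ {x y} →
    R x y ⊎ S x y → R (app g x) (app g y) ⊎ S (app g x) (app g y)
  step-invariant g∈ = [ inj₁ ∘ R.invariant g∈ , inj₂ ∘ S.invariant g∈ ]′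

Total-InLinf : ∀ G → InLinf G Total
Total-InLinf G =
  (record { refl = tt ; sym = λ _ → tt ; trans = λ _ _ → tt } , λ _ _ _ _ _ → tt)
  , λ _ → inj₁ ℕ-infinite

InLinf-resp-≐ : ∀ {G R S} → InLinf G R → R ≐ S → InLinf G S
InLinf-resp-≐ {G} {R} {S} ((eqR , invR) , classes) (R⊑S , S⊑R) =
  (record { refl  = R⊑S R.refl
          ; sym   = R⊑S ∘ R.sym ∘ S⊑R
          ; trans = λ s s′ → R⊑S (R.trans (S⊑R s) (S⊑R s′)) }
  , λ g g∈ x y → R⊑S ∘ invR g g∈ x y ∘ S⊑R)
  , λ x → [ (λ inf → inj₁ (inf ∘ Finite-⊆ R⊑S)) , (λ ker → inj₂ λ y → ker y ∘ S⊑R) ]′ (classes x)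
  where module R = IsEquivalence eqR

module Classical (em : ExcludedMiddle 0ℓ) where

  ¬Infinite⇒Finite : ∀ {S} → ¬ Infinite S → Finite S
  ¬Infinite⇒Finite ¬inf = decidable-stable em ¬inf

  Infinite⇒∉ : ∀ {S} → Infinite S → ∀ xs → ∃[ y ] (S y × y ∉ xs)
  Infinite⇒∉ inf xs = decidable-stable em λ ¬fresh →
    inf (xs , λ y Sy → decidable-stable em λ y∉ → ¬fresh (y , Sy , y∉))

  Infinite⇒Unique : ∀ {S} → Infinite S → ∀ n → ∃[ xs ] (Unique xs × length xs ≡ n × All S xs)
  Infinite⇒Unique inf zero = [] , [] , refl , []
  Infinite⇒Unique inf (suc n) with Infinite⇒Unique inf n
  ... | xs , unique , len , all with Infinite⇒∉ inf xs
  ... | y , Sy , y∉ =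
    y ∷ xs , All.tabulate (λ { z∈ refl → y∉ z∈ }) ∷ unique , cong suc len , Sy ∷ all

  covered⊎extendable : ∀ {T : Rel ℕ 0ℓ} {j} {p : Vector ℕ j} → Symmetric T →
    Distinct T p → ∀ x → (∃[ i ] T x (p i)) ⊎ Distinct T (x ∷ᵥ p)
  covered⊎extendable {T} {p = p} sym inj x with em {∃[ i ] T x (p i)}
  ... | yes covered = inj₁ covered
  ... | no ¬covered = inj₂ (∷ᵥ-distinct {p = p} {w = x} sym inj λ i t → ¬covered (i , t))

  coarsenings-enumerable : ∀ {M : Partition} {j} (p : Vector ℕ j) → (∀ x → ∃[ i ] M x (p i)) →
    ∃[ Ps ] (∀ {R} → IsEquivalence R → M ⊑ R → Any (R ≐_) Ps)
  coarsenings-enumerable {M} {j} p covered = map relation (allRelations j) , complete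
    where
    class : ℕ → Fin j
    class x = proj₁ (covered x)
    -- a coarsening of M is determined by which pairs of M-blocks it merges
    relation : (Fin j → Fin j → Fin 2) → Partition
    relation h x y = h (class x) (class y) ≡ suc zero
    code : Partition → Fin j → Fin j → Fin 2
    code R a b = indicator (em {R (p a) (p b)})
    complete : ∀ {R} → IsEquivalence R → M ⊑ R → Any (R ≐_) (map relation (allRelations j))
    complete {R} eqR M⊑R with find (allRelations-complete (code R))
    ... | h , h∈ , h≗code = Anyₚ.map⁺ (lose h∈ (R⊑ , ⊑R))
      where
      module R = IsEquivalence eqR
      near : ∀ x → R x (p (class x))
      near x = M⊑R (proj₂ (covered x))
      R⊑ : R ⊑ relation h
      R⊑ {x} {y} r = trans (h≗code _ _)
        (⇒indicator≡1 em (R.trans (R.sym (near x)) (R.trans r (near y))))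
      ⊑R : relation h ⊑ R
      ⊑R {x} {y} e = R.trans (near x) (R.trans
        (indicator≡1⇒ em (trans (sym (h≗code _ _)) e)) (R.sym (near y)))

  module Count (R : Partition) where

    inClass? : ∀ z → Decidable (R z)
    inClass? z y = em

    count : ℕ → List ℕ → ℕ
    count z xs = length (filter (inClass? z) xs)

    count-⊆ : ∀ z {xs ys} → Unique xs → xs ⊆ ys → count z xs ≤ count z ys
    count-⊆ z {xs} unique xs⊆ys = Unique-⊆⇒length-≤ (Uniqueₚ.filter⁺ (inClass? z) unique)
      λ y∈ → let y∈xs , Rzy = ∈-filter⁻ (inClass? z) {xs = xs} y∈
             in ∈-filter⁺ (inClass? z) (xs⊆ys y∈xs) Rzy

    count-cong : ∀ z {xs ys} → Unique xs → Unique ys → (∀ y → (y ∈ xs) ⇔ (y ∈ ys)) →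
      count z xs ≡ count z ys
    count-cong z uxs uys same = ≤-antisym
      (count-⊆ z uxs (Equivalence.to (same _))) (count-⊆ z uys (Equivalence.from (same _)))

    count-all : ∀ z {xs} → All (R z) xs → count z xs ≡ length xs
    count-all z all = cong length (Listₚ.filter-all (inClass? z) all)

    count-none : ∀ z {xs} → All (¬_ ∘ R z) xs → count z xs ≡ 0
    count-none z none = cong length (Listₚ.filter-none (inClass? z) none)

    count-++ : ∀ z xs ys → count z (xs ++ ys) ≡ count z xs + count z ys
    count-++ z xs ys = trans (cong length (Listₚ.filter-++ (inClass? z) xs ys))
                             (Listₚ.length-++ (filter (inClass? z) xs))

    count-⋃ : ∀ z {n} (F : Vector (List ℕ) n) → count z (⋃ F) ≡ ∑ (count z ∘ F)
    count-⋃ z {zero}  F = refl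
    count-⋃ z {suc n} F =
      trans (count-++ z (F zero) _) (cong (count z (F zero) +_) (count-⋃ z (F ∘ suc)))

    count-map : (f : ℕ → ℕ) → (∀ {x y} → R x y → R (f x) (f y)) →
      (∀ {x y} → R (f x) (f y) → R x y) → ∀ z xs → count (f z) (map f xs) ≡ count z xs
    count-map f fwd bwd z [] = refl
    count-map f fwd bwd z (x ∷ xs) with em {R (f z) (f x)} | em {R z x}
    ... | yes _ | yes _ = cong suc (count-map f fwd bwd z xs)
    ... | yes r | no ¬r = ⊥-elim (¬r (bwd r))
    ... | no ¬r | yes r = ⊥-elim (¬r (fwd r))
    ... | no _  | no _  = count-map f fwd bwd z xs

module ProfileBound (em : ExcludedMiddle 0ℓ) (G : PermGroup) (c k : ℕ)
                    (profile≤ : ∀ n → OrbitsAtMost G (c * (1 + n) ^ k) n) where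
  open Classical em

  module _ {R : Partition} (bs : IsBlockSystem G R) where
    private
      module R = BlockSystem G R bs
      open Count R

      m D X n : ℕ
      m = suc k
      D = suc (c * (1 + suc m * suc m) ^ k)
      X = suc m * D
      n = suc m * X

      profile<D^m : c * (1 + n) ^ k < D ^ m
      profile<D^m = begin-strict
        c * (1 + n) ^ k                   ≤⟨ *-monoʳ-≤ c (^-monoˡ-≤ k 1+n≤) ⟩
        c * ((1 + C) * D) ^ k             ≡⟨ cong (c *_) (^-distribʳ-* (1 + C) D k) ⟩
        c * ((1 + C) ^ k * D ^ k)         ≡⟨ *-assoc c _ _ ⟨
        c * (1 + C) ^ k * D ^ k           <⟨ +-monoˡ-< _ (m^n>0 D k) ⟩
        D ^ m                             ∎
        where
        open ≤-Reasoning
        C : ℕ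
        C = suc m * suc m
        1+n≤ : 1 + n ≤ (1 + C) * D
        1+n≤ = subst (λ w → 1 + w ≤ (1 + C) * D) (*-assoc (suc m) (suc m) D)
                     (+-monoˡ-≤ (C * D) (s≤s z≤n))

      module ManyInfiniteBlocks (b : Vector ℕ (suc m)) (b-inj : Distinct R b)
                                (b-inf : ∀ t → Infinite (R (b t))) where

        pool : Vector (List ℕ) (suc m)
        pool t = proj₁ (Infinite⇒Unique (b-inf t) n)

        pool-unique : ∀ t → Unique (pool t)
        pool-unique t = proj₁ (proj₂ (Infinite⇒Unique (b-inf t) n))

        length-pool : ∀ t → length (pool t) ≡ n
        length-pool t = proj₁ (proj₂ (proj₂ (Infinite⇒Unique (b-inf t) n)))

        pool-inBlock : ∀ t → All (R (b t)) (pool t)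
        pool-inBlock t = proj₂ (proj₂ (proj₂ (Infinite⇒Unique (b-inf t) n)))

        -- Block i + 1 receives (i + 1) D + dᵢ < X points and block 0 the remaining
        -- n ∸ Σ ≥ X, so the number of points in the block of b (i + 1) recovers dᵢ.
        weight : Vector (Fin D) m → Vector ℕ m
        weight d i = toℕ (combine {suc m} {D} (suc i) (d i))

        size : Vector (Fin D) m → Vector ℕ (suc m)
        size d = (n ∸ ∑ (weight d)) ∷ᵥ weight d

        part : Vector (Fin D) m → Vector (List ℕ) (suc m)
        part d t = take (size d t) (pool t)

        points : Vector (Fin D) m → List ℕ
        points d = ⋃ (part d)

        weight<X : ∀ d i → weight d i < X
        weight<X d i = Finₚ.toℕ<n (combine (suc i) (d i))

        weight≢0 : ∀ d i → weight d i ≢ 0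
        weight≢0 d i w≡0 = 0≢1+n (trans (sym w≡0) (Finₚ.toℕ-combine (suc i) (d i)))

        weight-injective : ∀ d d′ {i j} → weight d i ≡ weight d′ j → i ≡ j × d i ≡ d′ j
        weight-injective d d′ {i} {j} e
          with Finₚ.combine-injective (suc i) (d i) (suc j) (d′ j) (Finₚ.toℕ-injective e)
        ... | sᵢ≡sⱼ , dᵢ≡d′ⱼ = Finₚ.suc-injective sᵢ≡sⱼ , dᵢ≡d′ⱼ

        ∑weight≤ : ∀ d → ∑ (weight d) ≤ m * X
        ∑weight≤ d = ∑-≤ (<⇒≤ ∘ weight<X d)

        X≤size₀ : ∀ d → X ≤ size d zero
        X≤size₀ d = subst (_≤ size d zero) (m+n∸n≡m X (m * X)) (∸-monoʳ-≤ n (∑weight≤ d))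

        size≤n : ∀ d t → size d t ≤ n
        size≤n d zero    = m∸n≤m n (∑ (weight d))
        size≤n d (suc i) = ≤-trans (<⇒≤ (weight<X d i)) (m≤m+n X (m * X))

        part-inBlock : ∀ d t → All (R (b t)) (part d t)
        part-inBlock d t = Allₚ.take⁺ (size d t) (pool-inBlock t)

        length-part : ∀ d t → length (part d t) ≡ size d t
        length-part d t = begin
          length (take (size d t) (pool t))   ≡⟨ Listₚ.length-take (size d t) (pool t) ⟩
          size d t ⊓ℕ length (pool t)         ≡⟨ cong (size d t ⊓ℕ_) (length-pool t) ⟩
          size d t ⊓ℕ n                       ≡⟨ m≤n⇒m⊓n≡m (size≤n d t) ⟩
          size d t                            ∎
          where open ≡-Reasoning

        subset : Vector (Fin D) m → Subset n
        subset d = points d , unique , length-points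
          where
          unique : Unique (points d)
          unique = Unique-⋃ (part d) (λ t → Uniqueₚ.take⁺ (size d t) (pool-unique t))
            λ {t} {t′} y∈ y∈′ → b-inj (R.trans (All.lookup (part-inBlock d t) y∈)
                                                (R.sym (All.lookup (part-inBlock d t′) y∈′)))
          length-points : length (points d) ≡ n
          length-points = begin
            length (⋃ (part d))          ≡⟨ length-⋃ (part d) ⟩
            ∑ (length ∘ part d)          ≡⟨ ∑-cong (length-part d) ⟩
            n ∸ ∑ (weight d) + ∑ (weight d) ≡⟨ m∸n+n≡m (≤-trans (∑weight≤ d) (m≤n+m (m * X) X)) ⟩
            n                            ∎
            where open ≡-Reasoning

        count-inBlock : ∀ d {z} t → R z (b t) → count z (points d) ≡ size d t
        count-inBlock d {z} t r = begin
          count z (points d)     ≡⟨ count-⋃ z (part d) ⟩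
          ∑ (count z ∘ part d)   ≡⟨ ∑-single _ t other ⟩
          count z (part d t)     ≡⟨ count-all z (All.map (R.trans r) (part-inBlock d t)) ⟩
          length (part d t)      ≡⟨ length-part d t ⟩
          size d t               ∎
          where
          open ≡-Reasoning
          other : ∀ t′ → t′ ≢ t → count z (part d t′) ≡ 0
          other t′ t′≢t = count-none z (All.map (λ r′ r″ →
            t′≢t (b-inj (R.trans r′ (R.trans (R.sym r″) r)))) (part-inBlock d t′))

        count-points : ∀ d z → (∃[ t ] count z (points d) ≡ size d t) ⊎ count z (points d) ≡ 0
        count-points d z with em {∃[ t ] R z (b t)}
        ... | yes (t , r) = inj₁ (t , count-inBlock d t r)
        ... | no ¬r = inj₂ (trans (count-⋃ z (part d)) (∑-zero λ t →
          count-none z (All.map (λ r′ r″ → ¬r (t , R.trans r″ (R.sym r′))) (part-inBlock d t))))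

        count-translate : ∀ {d d′ g} → g ∈ᴳ G →
          (∀ y → (y ∈ points d′) ⇔ (y ∈ map (app g) (points d))) →
          ∀ i → count (app g (b (suc i))) (points d′) ≡ weight d i
        count-translate {d} {d′} {g} g∈ d′≈gd i = begin
          count (app g (b (suc i))) (points d′)
            ≡⟨ count-cong _ (proj₁ (proj₂ (subset d′)))
                 (Uniqueₚ.map⁺ (app-injective g) (proj₁ (proj₂ (subset d)))) d′≈gd ⟩
          count (app g (b (suc i))) (map (app g) (points d))
            ≡⟨ count-map (app g) (R.invariant g∈) (R.reflect g∈) (b (suc i)) (points d) ⟩
          count (b (suc i)) (points d)
            ≡⟨ count-inBlock d (suc i) R.refl ⟩
          weight d i
            ∎
          where open ≡-Reasoning

        size-determines-digit : ∀ d d′ i {w} → w ≡ weight d i →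
          (∃[ t ] w ≡ size d′ t) ⊎ w ≡ 0 → d i ≡ d′ i
        size-determines-digit d d′ i w≡ (inj₂ w≡0) = ⊥-elim (weight≢0 d i (trans (sym w≡) w≡0))
        size-determines-digit d d′ i w≡ (inj₁ (zero , w≡size₀)) =
          ⊥-elim (<⇒≱ (weight<X d i) (subst (X ≤_) (trans (sym w≡size₀) w≡) (X≤size₀ d′)))
        size-determines-digit d d′ i w≡ (inj₁ (suc j , w≡weight))
          with weight-injective d d′ {i} {j} (trans (sym w≡) w≡weight)
        ... | refl , dᵢ≡d′ᵢ = dᵢ≡d′ᵢ

        same-orbit⇒≗ : ∀ {d d′} → SameOrbit G (subset d) (subset d′) → d ≗ d′
        same-orbit⇒≗ {d} {d′} (g , g∈ , d′≈gd) i = size-determines-digit d d′ i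
          (count-translate {d} {d′} g∈ d′≈gd i) (count-points d′ (app g (b (suc i))))

        digits : Fin (D ^ m) → Vector (Fin D) m
        digits = finToFun

        digits-injective : ∀ {x y} → digits x ≗ digits y → x ≡ y
        digits-injective {x} {y} = finToFun-injective {D} {m} {x} {y}

        absurd : ⊥
        absurd = <⇒≱ profile<D^m (OrbitsAtMost⇒≤ {G} (profile≤ n) (subset ∘ digits)
          (digits-injective ∘ same-orbit⇒≗))

    infinite-blocks-≤ : ∀ {j} (q : Vector ℕ j) → Distinct R q →
      (∀ i → Infinite (R (q i))) → j ≤ suc k
    infinite-blocks-≤ {j} q q-inj q-inf with j ≤? suc k
    ... | yes j≤ = j≤
    ... | no j≰ = ⊥-elim (ManyInfiniteBlocks.absurd (q ∘ restrict)
                   (λ r → Finₚ.inject≤-injective _ _ _ _ (q-inj r)) (q-inf ∘ restrict))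
      where
      restrict : Fin (suc m) → Fin j
      restrict t = inject≤ t (≰⇒> j≰)

  orbit-transversal-≤ : ∀ {j} (p : Vector ℕ j) → Distinct (Orbit G) p → j ≤ c * 2 ^ k
  orbit-transversal-≤ p p-inj = OrbitsAtMost⇒≤ {G} (profile≤ 1) singleton separated
    where
    singleton : ∀ i → Subset 1
    singleton i = p i ∷ [] , [] ∷ [] , refl
    separated : ∀ {i j} → SameOrbit G (singleton i) (singleton j) → i ≡ j
    separated {i} {j} (g , g∈ , same) with Equivalence.to (same (p j)) (here refl)
    ... | here pⱼ≡gpᵢ = p-inj (g , g∈ , sym pⱼ≡gpᵢ)

  kernel-finite : Finite (Kernel G)
  kernel-finite
    with bounded⇒maximal em KernelTransversal ((λ ()) , (λ ()) , empty-distinct {Orbit G} (λ ())) _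
           (λ (p , _ , p-inj) → orbit-transversal-≤ p p-inj)
    where
    KernelTransversal : ℕ → Set
    KernelTransversal j = Σ (Vector ℕ j) λ p → (∀ i → Kernel G (p i)) × Distinct (Orbit G) p
  ... | j , (p , finite , p-inj) , maximal = ⋃ (proj₁ ∘ finite) , covered
    where
    covered : ∀ y → Kernel G y → y ∈ ⋃ (proj₁ ∘ finite)
    covered y ker-y with covered⊎extendable {Orbit G} {p = p} (Orbit-sym G) p-inj y
    ... | inj₁ (i , pᵢ∼y) = ∈-⋃⁺ (proj₁ ∘ finite) i (proj₂ (finite i) y (Orbit-sym G pᵢ∼y))
    ... | inj₂ extended =
      ⊥-elim (maximal (y ∷ᵥ p , (λ { zero → ker-y ; (suc i) → finite i }) , extended))

  kernel : List ℕ
  kernel = proj₁ kernel-finite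

  blocks-≤ : ∀ {R} → InLinf G R → ∀ {j} (q : Vector ℕ j) → Distinct R q →
    j ≤ suc k + length kernel
  blocks-≤ {R} (bs , classes) {j} q q-inj = begin
    j                                  ≡⟨ Listₚ.length-tabulate id ⟨
    length (allFin j)                  ≡⟨ length-filter-∁ infinite? (allFin j) ⟨
    length infinite + length finite    ≤⟨ +-mono-≤ infinite-≤ finite-≤ ⟩
    suc k + length kernel              ∎
    where
    open ≤-Reasoning
    module R = BlockSystem G R bs
    infinite? : Decidable (λ i → Infinite (R (q i)))
    infinite? i = em
    infinite finite : List (Fin j)
    infinite = filter infinite? (allFin j)
    finite   = filter (∁? infinite?) (allFin j)
    q-injective : Injective _≡_ _≡_ q
    q-injective = q-inj ∘ R.reflexive
    infinite-≤ : length infinite ≤ suc k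
    infinite-≤ = infinite-blocks-≤ bs (q ∘ lookup infinite)
      (lookup-injective (Uniqueₚ.filter⁺ infinite? (Uniqueₚ.allFin⁺ j)) ∘ q-inj)
      (λ t → proj₂ (∈-filter⁻ infinite? {xs = allFin j} (∈-lookup t)))
    finite⊆kernel : map q finite ⊆ kernel
    finite⊆kernel y∈ with ∈-map⁻ q y∈
    ... | i , i∈ , refl with classes (q i)
    ...   | inj₁ inf = ⊥-elim (proj₂ (∈-filter⁻ (∁? infinite?) {xs = allFin j} i∈) inf)
    ...   | inj₂ ker = proj₂ kernel-finite (q i) (ker (q i) R.refl)
    finite-≤ : length finite ≤ length kernel
    finite-≤ = subst (_≤ length kernel) (Listₚ.length-map q finite)
      (Unique-⊆⇒length-≤ (Uniqueₚ.map⁺ q-injective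
        (Uniqueₚ.filter⁺ (∁? infinite?) (Uniqueₚ.allFin⁺ j))) finite⊆kernel)

  finitely-many-blocks : ∀ {R} → InLinf G R →
    ∃[ j ] Σ (Vector ℕ j) λ p → ∀ x → ∃[ i ] R x (p i)
  finitely-many-blocks {R} lR@(bs , _)
    with bounded⇒maximal em (λ j → Σ (Vector ℕ j) (Distinct R))
           ((λ ()) , empty-distinct {R} (λ ())) _ (λ (q , q-inj) → blocks-≤ lR q q-inj)
  ... | j , (p , p-inj) , maximal = j , p , covered
    where
    covered : ∀ x → ∃[ i ] R x (p i)
    covered x with covered⊎extendable {R} {p = p} (BlockSystem.sym G R bs) p-inj x
    ... | inj₁ R-covered = R-covered
    ... | inj₂ extended  = ⊥-elim (maximal (x ∷ᵥ p , extended))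

  finite-class⇒kernel : ∀ {Q} → IsBlockSystem G Q → ∀ {j} (C : Vector (ℕ → Set) j) →
    (∀ z → ∃[ i ] C i z) → (∀ i {z z′} → C i z → C i z′ → Q z z′) →
    ∀ {y} → Finite (Q y) → Kernel G y
  finite-class⇒kernel {Q} bs {j} C covering C⊆class {y} (class , complete) =
    ⋃ (λ i → translate (em {Reachable i})) , λ where _ (h , h∈ , refl) → in-translate h∈
    where
    module Q = BlockSystem G Q bs
    Reachable : Fin j → Set
    Reachable i = ∃[ g ] (g ∈ᴳ G × C i (app g y))
    -- a point h y of cell i is Q-related to g y for any g with g y in cell i, so it
    -- lies in the g-translate of the (finite) Q-class of y
    translate : ∀ {i} → Dec (Reachable i) → List ℕ
    translate (yes (g , _)) = map (app g) class
    translate (no _)        = []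
    hit : ∀ {h} → h ∈ᴳ G → ∀ i (d : Dec (Reachable i)) → C i (app h y) → app h y ∈ translate d
    hit h∈ i (no unreachable) hy∈Cᵢ = ⊥-elim (unreachable (_ , h∈ , hy∈Cᵢ))
    hit {h} h∈ i (yes (g , g∈ , gy∈Cᵢ)) hy∈Cᵢ =
      subst (_∈ map (app g) class) (app-app-sym g (app h y))
        (∈-map⁺ (app g) (complete _ (Q.translate⁻¹ g∈ (C⊆class i gy∈Cᵢ hy∈Cᵢ))))
    in-translate : ∀ {h} → h ∈ᴳ G → app h y ∈ ⋃ (λ i → translate (em {Reachable i}))
    in-translate {h} h∈ with i , hy∈Cᵢ ← covering (app h y) =
      ∈-⋃⁺ (λ i → translate (em {Reachable i})) i (hit h∈ i em hy∈Cᵢ)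

  ⊓-InLinf : ∀ {R S} → InLinf G R → InLinf G S → InLinf G (R ⊓ S)
  ⊓-InLinf {R} {S} lR@(bsR , _) lS@(bsS , _) = bs , classes
    where
    module R = BlockSystem G R bsR
    module S = BlockSystem G S bsS
    bs : IsBlockSystem G (R ⊓ S)
    bs = ⊓-IsBlockSystem {G} {R} {S} bsR bsS
    jR = proj₁ (finitely-many-blocks lR)
    jS = proj₁ (finitely-many-blocks lS)
    p = proj₁ (proj₂ (finitely-many-blocks lR))
    q = proj₁ (proj₂ (finitely-many-blocks lS))
    -- the cells R-block ∩ S-block, indexed through Fin (jR * jS) ≅ Fin jR × Fin jS
    InCell : ℕ → Fin jR × Fin jS → Set
    InCell z (i , i′) = R z (p i) × S z (q i′)
    cell : Vector (ℕ → Set) (jR * jS)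
    cell t z = InCell z (remQuot jS t)
    covering : ∀ z → ∃[ t ] cell t z
    covering z with i , Rzpᵢ ← proj₂ (proj₂ (finitely-many-blocks lR)) z
                  | i′ , Szqᵢ′ ← proj₂ (proj₂ (finitely-many-blocks lS)) z =
      combine i i′ , subst (InCell z) (sym (Finₚ.remQuot-combine i i′)) (Rzpᵢ , Szqᵢ′)
    cell⊆class : ∀ t {z z′} → cell t z → cell t z′ → (R ⊓ S) z z′
    cell⊆class t with remQuot {jR} jS t
    ... | i , i′ = λ (r , s) (r′ , s′) → R.trans r (R.sym r′) , S.trans s (S.sym s′)
    classes : ∀ x → Infinite ((R ⊓ S) x) ⊎ (∀ y → (R ⊓ S) x y → Kernel G y)
    classes x with em {Infinite ((R ⊓ S) x)}
    ... | yes infinite = inj₁ infinite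
    ... | no ¬infinite = inj₂ λ y (r , s) → finite-class⇒kernel bs cell covering cell⊆class
      (Finite-⊆ (λ (r′ , s′) → R.trans r r′ , S.trans s s′) (¬Infinite⇒Finite ¬infinite))

  ⊔-InLinf : ∀ {R S} → InLinf G R → InLinf G S → InLinf G (R ⊔ S)
  ⊔-InLinf {R} {S} (bsR , classesR) (bsS , _) = ⊔-IsBlockSystem {G} {R} {S} bsR bsS , classes
    where
    module R = BlockSystem G R bsR
    classes : ∀ x → Infinite ((R ⊔ S) x) ⊎ (∀ y → (R ⊔ S) x y → Kernel G y)
    classes x with em {Infinite ((R ⊔ S) x)}
    ... | yes infinite = inj₁ infinite
    ... | no ¬infinite = inj₂ λ y x∼y → [ (λ infinite → ⊥-elim (infinite
      (Finite-⊆ (λ r → x∼y ◅◅ inj₁ r ◅ ε) (¬Infinite⇒Finite ¬infinite))))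
      , (λ ker → ker y R.refl) ]′ (classesR y)

  module _ (em₁ : ExcludedMiddle (lsuc 0ℓ)) where

    L∞-Transversal : ℕ → Set₁
    L∞-Transversal j = Σ Partition λ R → InLinf G R × Σ (Vector ℕ j) (Distinct R)

    finest : ∃[ j ] (L∞-Transversal j × ¬ L∞-Transversal (suc j))
    finest = bounded⇒maximal em₁ L∞-Transversal
      (Total , Total-InLinf G , (λ ()) , empty-distinct {Total} (λ ())) _
      (λ (R , lR , q , q-inj) → blocks-≤ lR q q-inj)

    module Finest (j : ℕ) (M : Partition) (lM : InLinf G M)
                  (p : Vector ℕ j) (p-inj : Distinct M p) (maximal : ¬ L∞-Transversal (suc j)) where
      private module M = BlockSystem G M (proj₁ lM)

      M-covered : ∀ x → ∃[ i ] M x (p i)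
      M-covered x with covered⊎extendable {M} {p = p} M.sym p-inj x
      ... | inj₁ covered = covered
      ... | inj₂ extended = ⊥-elim (maximal (M , lM , x ∷ᵥ p , extended))

      M-minimum : ∀ {R} → InLinf G R → M ⊑ R
      M-minimum {R} lR {x} {y} Mxy with em {R x y}
      ... | yes Rxy = Rxy
      ... | no ¬Rxy = ⊥-elim (maximal (M ⊓ R , ⊓-InLinf lM lR , w ∷ᵥ p ,
            ∷ᵥ-distinct {M ⊓ R} {p = p} {w = w}
              (λ (m , r) → M.sym m , R.sym r) (p-inj ∘ proj₁) new))
        where
        module R = BlockSystem G R (proj₁ lR)
        i₀ = proj₁ (M-covered x)
        Mxpᵢ₀ = proj₂ (M-covered x)
        -- as ¬ R x y, the points x, y of the M-block of p i₀ are not both R-related to p i₀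
        outlier : ∃[ w ] (M w (p i₀) × ¬ R w (p i₀))
        outlier with em {R x (p i₀)}
        ... | no ¬Rxpᵢ₀ = x , Mxpᵢ₀ , ¬Rxpᵢ₀
        ... | yes Rxpᵢ₀ =
          y , M.trans (M.sym Mxy) Mxpᵢ₀ , λ Rypᵢ₀ → ¬Rxy (R.trans Rxpᵢ₀ (R.sym Rypᵢ₀))
        w = proj₁ outlier
        new : ∀ i → ¬ (M ⊓ R) w (p i)
        new i (Mwpᵢ , Rwpᵢ) with p-inj (M.trans (M.sym (proj₁ (proj₂ outlier))) Mwpᵢ)
        ... | refl = proj₂ (proj₂ outlier) Rwpᵢ

      L∞-finite : ∃[ Rs ] (All (InLinf G) Rs × (∀ R → InLinf G R → Any (R ≐_) Rs))
      L∞-finite with Ps , complete ← coarsenings-enumerable p M-covered =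
        filter inLinf? Ps , Allₚ.all-filter inLinf? Ps , listed
        where
        inLinf? : Decidable (InLinf G)
        inLinf? R = em
        listed : ∀ R → InLinf G R → Any (R ≐_) (filter inLinf? Ps)
        listed R lR with S , S∈ , R≐S ← find (complete (proj₁ (proj₁ lR)) (M-minimum lR)) =
          lose (∈-filter⁺ inLinf? S∈ (InLinf-resp-≐ {G} lR R≐S)) R≐S

proposition3p9 : ExcludedMiddle 0ℓ → ExcludedMiddle (lsuc 0ℓ) →
    (G : PermGroup) → POligomorphic G →
    -- finiteness of L^∞(G) (up to equality of partitions)
    (∃[ Rs ] (All (InLinf G) Rs × (∀ R → InLinf G R → Any (λ S → R ≐ S) Rs)))
    -- sublattice: closed under meets and joins of set partitions
    × (∀ R S → InLinf G R → InLinf G S → InLinf G (R ⊓ S) × InLinf G (R ⊔ S))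
    -- minimum
    × (∃[ M ] (InLinf G M × (∀ R → InLinf G R → M ⊑ R)))
    -- maximum is the trivial block system {E}
    × (InLinf G Total × (∀ R → InLinf G R → R ⊑ Total))
proposition3p9 em em₁ G (c , k , profile≤)
  with j , (M , lM , p , p-inj) , maximal ← ProfileBound.finest em G c k profile≤ em₁ =
    L∞-finite
  , (λ R S lR lS → ⊓-InLinf lR lS , ⊔-InLinf lR lS)
  , (M , lM , λ R → M-minimum)
  , (Total-InLinf G , λ _ _ _ → tt)
  where
  open ProfileBound em G c k profile≤
  open Finest em₁ j M lM p p-inj maximal
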